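{- Let $(c_n)_{n\ge1}$ be a sequence (of elements of a commutative ring) and let $$y_n=\sum_{k=0}^n\frac{k!}{n!}B_{n,k}(1!c_1,2!c_2,\dots)\quad(n\ge0).$$ For a positive integer $r$, define the convolution sequence $$y_n^{(r)}=\sum_{m_1+\cdots+m_r=n}y_{m_1}\cdots y_{m_r}\quad(n\ge0),$$ the sum over all $r$-tuples of nonnegative integers with $m_1+\cdots+m_r=n$. Then for all $n\ge1$, $$n\,y_n^{(r)}=\sum_{m=1}^n\,[n+m(r-1)]\,c_m\,y_{n-m}^{(r)}.$$
   Context: $B_{n,k}(x_1,x_2,\dots)$ denotes the $(n,k)$-th partial Bell polynomial: $B_{0,0}=1$ and $$B_{n,k}(x_1,x_2,\dots)=\sum \frac{n!}{j_1!j_2!\cdots}\prod_{i\ge1}\Big(\frac{x_i}{i!}\Big)^{j_i},$$ the sum over all tuples of nonnegative integers $(j_1,j_2,\dots)$ with $j_1+j_2+\cdots=k$ and $j_1+2j_2+\cdots=n$. The quantity $\frac{k!}{n!}B_{n,k}(1!c_1,2!c_2,\dots)=\sum\frac{k!}{j_1!j_2!\cdots}\prod_ic_i^{j_i}$ is an integer-coefficient polynomial in the $c_i$. Equivalently, $\sum_{n\ge0}y_nt^n$ is the reciprocal of $1-\sum_{n\ge1}c_nt^n$, and $y_n^{(r)}$ is the coefficient of $t^n$ in its $r$-th power. -}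

module Defs where

open import Level using (Level)
open import Data.Nat as ℕ using (ℕ; zero; suc; _∸_; NonZero)
open import Data.Nat.Properties using (_≟_; _!≢0; m*n≢0)
open import Data.Nat.DivMod using (_/_)
open import Data.Nat using (_!)
open import Data.Bool using (Bool; if_then_else_; _∧_)
open import Data.List using (List; []; _∷_; map; concatMap; filter; upTo; foldr)
open import Data.Vec using (Vec; []; _∷_; toList)
open import Relation.Nullary using (does)
open import Relation.Nullary.Decidable using (yes; no)
open import Algebra.Bundles using (CommutativeRing; Semiring)
import Algebra.Definitions.RawSemiring as RS

boundedVecs : (len b : ℕ) → List (Vec ℕ len)
boundedVecs zero    b = [] ∷ []
boundedVecs (suc l) b = concatMap (λ x → map (x ∷_) (boundedVecs l b)) (upTo (suc b))

sumℕ : List ℕ → ℕ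
sumℕ = foldr ℕ._+_ 0

weightFrom : ℕ → List ℕ → ℕ
weightFrom i []       = 0
weightFrom i (j ∷ js) = i ℕ.* j ℕ.+ weightFrom (suc i) js

factProd : List ℕ → ℕ
factProd []       = 1
factProd (j ∷ js) = j ! ℕ.* factProd js

factProd≢0 : ∀ js → NonZero (factProd js)
factProd≢0 []       = _
factProd≢0 (j ∷ js) = m*n≢0 (j !) (factProd js) {{j !≢0}} {{factProd≢0 js}}

multinom : ℕ → List ℕ → ℕ
multinom k js = (k ! / factProd js) {{factProd≢0 js}}

-- Tuples (j_1,…,j_n) of naturals with Σ j_i = k and Σ i j_i = n.
-- (For such tuples necessarily j_i = 0 for i > n and j_i ≤ n, so this
-- enumeration is exhaustive.)
bellTuples : (n k : ℕ) → List (List ℕ)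
bellTuples n k =
  filter (λ js → sumℕ js ≟ k) (filter (λ js → weightFrom 1 js ≟ n)
    (map toList (boundedVecs n n)))

compositions : (r n : ℕ) → List (List ℕ)
compositions r n = filter (λ ms → sumℕ ms ≟ n) (map toList (boundedVecs r n))

module Seq {a ℓ : Level} (R : CommutativeRing a ℓ) where
  open CommutativeRing R
  open RS (Semiring.rawSemiring semiring) using (_×_; _^_) public

  sumR : List Carrier → Carrier
  sumR = foldr _+_ 0#

  prodR : List Carrier → Carrier
  prodR = foldr _*_ 1#

  monoFrom : (ℕ → Carrier) → ℕ → List ℕ → Carrier
  monoFrom c i []       = 1#
  monoFrom c i (j ∷ js) = (c i ^ j) * monoFrom c (suc i) js

  -- (k!/n!) B_{n,k}(1! c_1, 2! c_2, …) = Σ k!/(j_1! j_2! ⋯) ∏ c_i^{j_i}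
  bellNorm : (ℕ → Carrier) → ℕ → ℕ → Carrier
  bellNorm c n k = sumR (map (λ js → multinom k js × monoFrom c 1 js) (bellTuples n k))

  y : (ℕ → Carrier) → ℕ → Carrier
  y c n = sumR (map (bellNorm c n) (upTo (suc n)))

  yPow : (ℕ → Carrier) → ℕ → ℕ → Carrier
  yPow c r n = sumR (map (λ ms → prodR (map (y c) ms)) (compositions r n))

  sumFrom1 : ℕ → (ℕ → Carrier) → Carrier
  sumFrom1 n f = sumR (map (λ i → f (suc i)) (upTo n))

-- The generating function Y(t) = Σ yₙ tⁿ is the reciprocal of 1 − C(t), C(t) = Σ_{n≥1} cₙ tⁿ: by
-- Pascal's rule for multinomial coefficients, singling out the part containing one element gives
-- yₙ = Σₘ cₘ yₙ₋ₘ. With the Euler operator θ = t d/dt, differentiating (1 − C) Y = 1 gives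
-- (1 − C) θY = θC · Y, hence (1 − C) θ(Yʳ) = r θC · Yʳ. Comparing coefficients of tⁿ,
-- n y⁽ʳ⁾ₙ − Σₘ (n − m) cₘ y⁽ʳ⁾ₙ₋ₘ = r Σₘ m cₘ y⁽ʳ⁾ₙ₋ₘ, which is the claim.

module Submission where

open import Defs
open import Level using (Level)
open import Data.Nat using (ℕ; _+_; _*_; _∸_; _≤_)
open import Algebra.Bundles using (CommutativeRing)

open import Algebra.Bundles using (CommutativeSemiring)
import Algebra.Properties.CommutativeSemigroup as CommSemigroupProperties
open import Data.Bool using (true; false; if_then_else_)
open import Data.Empty using (⊥-elim)
open import Data.List using (List; []; _∷_; map; filter; upTo; applyUpTo; concatMap; foldr; length; _++_; replicate)
import Data.List.Properties as List
open import Data.Nat using (zero; suc; pred; _<_; z≤n; s≤s; _!)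
import Data.Nat.Properties as ℕ
open import Data.Nat.Combinatorics using (k![n∸k]!∣n!)
open import Data.Nat.Divisibility using (_∣_; ∣-refl; ∣-trans; *-monoʳ-∣)
open import Data.Nat.DivMod using (m/n*n≡m; /-congʳ)
open import Data.Nat.Solver using (module +-*-Solver)
open import Data.Vec using (Vec; toList) renaming (_∷_ to _∷ᵥ_)
open import Function using (_∘_)
open import Relation.Binary.PropositionalEquality as ≡ using (_≡_; _≢_)
open import Relation.Nullary using (does; yes; no)
open import Relation.Nullary.Decidable using (dec-true; dec-false)
open import Relation.Unary using (Pred; Decidable)

module FiniteSums {c ℓ} (S : CommutativeSemiring c ℓ) where
  open CommutativeSemiring S renaming (_+_ to _⊕_; _*_ to _·_)
  open CommSemigroupProperties +-commutativeSemigroup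
    using () renaming (interchange to +-interchange)
  open import Relation.Binary.Reasoning.Setoid setoid

  private
    variable
      A B : Set

  sum : List Carrier → Carrier
  sum = foldr _⊕_ 0#

  product : List Carrier → Carrier
  product = foldr _·_ 1#

  sumOver : List A → (A → Carrier) → Carrier
  sumOver xs f = sum (map f xs)

  syntax sumOver xs (λ x → e) = ∑[ x ∈ xs ] e

  sumTo : ℕ → (ℕ → Carrier) → Carrier
  sumTo n f = sum (applyUpTo f n)

  syntax sumTo n (λ i → e) = ∑[ i < n ] e

  sumOver-cong : ∀ xs {f g : A → Carrier} → (∀ x → f x ≈ g x) → sumOver xs f ≈ sumOver xs g
  sumOver-cong []       f≈g = refl
  sumOver-cong (x ∷ xs) f≈g = +-cong (f≈g x) (sumOver-cong xs f≈g)

  sumOver-≈0 : ∀ xs {f : A → Carrier} → (∀ x → f x ≈ 0#) → sumOver xs f ≈ 0#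
  sumOver-≈0 []       f≈0 = refl
  sumOver-≈0 (x ∷ xs) f≈0 = trans (+-cong (f≈0 x) (sumOver-≈0 xs f≈0)) (+-identityˡ 0#)

  sumOver-distrib-⊕ : ∀ xs (f g : A → Carrier) →
                      ∑[ x ∈ xs ] (f x ⊕ g x) ≈ sumOver xs f ⊕ sumOver xs g
  sumOver-distrib-⊕ []       f g = sym (+-identityˡ 0#)
  sumOver-distrib-⊕ (x ∷ xs) f g =
    trans (+-congˡ (sumOver-distrib-⊕ xs f g)) (+-interchange _ _ _ _)

  *-distribˡ-sumOver : ∀ xs k (f : A → Carrier) → k · sumOver xs f ≈ ∑[ x ∈ xs ] (k · f x)
  *-distribˡ-sumOver []       k f = zeroʳ k
  *-distribˡ-sumOver (x ∷ xs) k f = trans (distribˡ k _ _) (+-congˡ (*-distribˡ-sumOver xs k f))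

  sumOver-comm : ∀ xs (ys : List B) (f : A → B → Carrier) →
                 ∑[ x ∈ xs ] sumOver ys (f x) ≈ ∑[ y ∈ ys ] ∑[ x ∈ xs ] f x y
  sumOver-comm []       ys f = sym (sumOver-≈0 ys (λ _ → refl))
  sumOver-comm (x ∷ xs) ys f =
    trans (+-congˡ (sumOver-comm xs ys f)) (sym (sumOver-distrib-⊕ ys (f x) _))

  sumOver-filter : ∀ {p} {Q : Pred A p} (Q? : Decidable Q) xs (f : A → Carrier) →
                   sumOver (filter Q? xs) f ≈ ∑[ x ∈ xs ] (if does (Q? x) then f x else 0#)
  sumOver-filter Q? []       f = refl
  sumOver-filter Q? (x ∷ xs) f with does (Q? x)
  ... | true  = +-congˡ (sumOver-filter Q? xs f)
  ... | false = trans (sumOver-filter Q? xs f) (sym (+-identityˡ _))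

  sumOver-++ : ∀ xs ys (f : A → Carrier) → sumOver (xs ++ ys) f ≈ sumOver xs f ⊕ sumOver ys f
  sumOver-++ []       ys f = sym (+-identityˡ _)
  sumOver-++ (x ∷ xs) ys f = trans (+-congˡ (sumOver-++ xs ys f)) (sym (+-assoc _ _ _))

  sumOver-concatMap : ∀ xs (h : A → List B) (f : B → Carrier) →
                      sumOver (concatMap h xs) f ≈ ∑[ x ∈ xs ] sumOver (h x) f
  sumOver-concatMap []       h f = refl
  sumOver-concatMap (x ∷ xs) h f =
    trans (sumOver-++ (h x) _ f) (+-congˡ (sumOver-concatMap xs h f))

  sumOver-map : ∀ xs (g : A → B) (f : B → Carrier) → sumOver (map g xs) f ≡ sumOver xs (f ∘ g)
  sumOver-map xs g f = ≡.cong sum (≡.sym (List.map-∘ xs))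

  sumTo≡sumOver-upTo : ∀ n f → sumTo n f ≡ sumOver (upTo n) f
  sumTo≡sumOver-upTo n f = ≡.cong sum (≡.sym (List.map-applyUpTo (λ i → i) f n))

  sumTo-cong : ∀ n {f g : ℕ → Carrier} → (∀ i → i < n → f i ≈ g i) → sumTo n f ≈ sumTo n g
  sumTo-cong zero    f≈g = refl
  sumTo-cong (suc n) f≈g = +-cong (f≈g 0 (s≤s z≤n)) (sumTo-cong n (λ i i<n → f≈g (suc i) (s≤s i<n)))

  sumTo-≈0 : ∀ n {f : ℕ → Carrier} → (∀ i → i < n → f i ≈ 0#) → sumTo n f ≈ 0#
  sumTo-≈0 zero    f≈0 = refl
  sumTo-≈0 (suc n) f≈0 =
    trans (+-cong (f≈0 0 (s≤s z≤n)) (sumTo-≈0 n (λ i i<n → f≈0 (suc i) (s≤s i<n)))) (+-identityˡ 0#)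

  sumTo-distrib-⊕ : ∀ n (f g : ℕ → Carrier) → ∑[ i < n ] (f i ⊕ g i) ≈ sumTo n f ⊕ sumTo n g
  sumTo-distrib-⊕ zero    f g = sym (+-identityˡ 0#)
  sumTo-distrib-⊕ (suc n) f g = trans (+-congˡ (sumTo-distrib-⊕ n (f ∘ suc) (g ∘ suc))) (+-interchange _ _ _ _)

  *-distribˡ-sumTo : ∀ n k (f : ℕ → Carrier) → k · sumTo n f ≈ ∑[ i < n ] (k · f i)
  *-distribˡ-sumTo zero    k f = zeroʳ k
  *-distribˡ-sumTo (suc n) k f = trans (distribˡ k _ _) (+-congˡ (*-distribˡ-sumTo n k (f ∘ suc)))

  *-distribʳ-sumTo : ∀ n k (f : ℕ → Carrier) → sumTo n f · k ≈ ∑[ i < n ] (f i · k)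
  *-distribʳ-sumTo n k f =
    trans (*-comm _ k) (trans (*-distribˡ-sumTo n k f) (sumTo-cong n (λ i _ → *-comm k (f i))))

  sumTo-last : ∀ n (f : ℕ → Carrier) → sumTo (suc n) f ≈ sumTo n f ⊕ f n
  sumTo-last zero    f = trans (+-identityʳ _) (sym (+-identityˡ _))
  sumTo-last (suc n) f = trans (+-congˡ (sumTo-last n (f ∘ suc))) (sym (+-assoc _ _ _))

  sumTo-extend : ∀ n d (f : ℕ → Carrier) → (∀ i → n ≤ i → f i ≈ 0#) → sumTo (n + d) f ≈ sumTo n f
  sumTo-extend zero    d f f≈0 = sumTo-≈0 d (λ i _ → f≈0 i z≤n)
  sumTo-extend (suc n) d f f≈0 = +-congˡ (sumTo-extend n d (f ∘ suc) (λ i n≤i → f≈0 (suc i) (s≤s n≤i)))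

  sumTo-truncate : ∀ w N (f : ℕ → Carrier) → w < N → (∀ i → w < i → f i ≈ 0#) →
                   sumTo N f ≈ sumTo (suc w) f
  sumTo-truncate w N f w<N f≈0 =
    ≡.subst (λ M → sumTo M f ≈ sumTo (suc w) f) (ℕ.m+[n∸m]≡n w<N) (sumTo-extend (suc w) (N ∸ suc w) f f≈0)

  sumTo-reverse : ∀ n (f : ℕ → Carrier) → sumTo n f ≈ ∑[ i < n ] f (n ∸ suc i)
  sumTo-reverse zero    f = refl
  sumTo-reverse (suc n) f = begin
    f 0 ⊕ sumTo n (f ∘ suc)
      ≈⟨ +-congˡ (sumTo-reverse n (f ∘ suc)) ⟩
    f 0 ⊕ ∑[ i < n ] f (suc (n ∸ suc i))
      ≈⟨ +-comm _ _ ⟩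
    ∑[ i < n ] f (suc (n ∸ suc i)) ⊕ f 0
      ≈⟨ +-cong (sumTo-cong n (λ i i<n → reflexive (≡.cong f (≡.sym (ℕ.+-∸-assoc 1 i<n)))))
                (reflexive (≡.cong f (≡.sym (ℕ.n∸n≡0 n)))) ⟩
    ∑[ i < n ] f (n ∸ i) ⊕ f (n ∸ n)
      ≈⟨ sumTo-last n (λ i → f (n ∸ i)) ⟨
    ∑[ i < suc n ] f (n ∸ i) ∎

  -- Iverson brackets, phrased with does so that sumOver-filter produces them verbatim.
  [_≟_]_ : ℕ → ℕ → Carrier → Carrier
  [ p ≟ q ] x = if does (p ℕ.≟ q) then x else 0#

  [≟]-≢ : ∀ {p q} x → p ≢ q → [ p ≟ q ] x ≡ 0#
  [≟]-≢ {p} {q} x p≢q rewrite dec-false (p ℕ.≟ q) p≢q = ≡.refl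

  [≟]-cong : ∀ p q {x z} → (p ≡ q → x ≈ z) → [ p ≟ q ] x ≈ [ p ≟ q ] z
  [≟]-cong p q x≈z with p ℕ.≟ q
  ... | yes p≡q rewrite dec-true  (p ℕ.≟ q) p≡q = x≈z p≡q
  ... | no  p≢q rewrite dec-false (p ℕ.≟ q) p≢q = refl

  [≟]-0# : ∀ p q → [ p ≟ q ] 0# ≈ 0#
  [≟]-0# p q with does (p ℕ.≟ q)
  ... | true  = refl
  ... | false = refl

  [≟]-*ˡ : ∀ p q k x → [ p ≟ q ] (k · x) ≈ k · [ p ≟ q ] x
  [≟]-*ˡ p q k x with does (p ℕ.≟ q)
  ... | true  = refl
  ... | false = sym (zeroʳ k)

  [≟]-sumTo : ∀ p q n f → [ p ≟ q ] sumTo n f ≈ ∑[ i < n ] [ p ≟ q ] f i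
  [≟]-sumTo p q n f with does (p ℕ.≟ q)
  ... | true  = refl
  ... | false = sym (sumTo-≈0 n (λ _ _ → refl))

  [+≟]≡[≟∸] : ∀ a s n x → a ≤ n → [ a + s ≟ n ] x ≡ [ s ≟ n ∸ a ] x
  [+≟]≡[≟∸] zero    s n       x _         = ≡.refl
  [+≟]≡[≟∸] (suc a) s (suc n) x (s≤s a≤n) = [+≟]≡[≟∸] a s n x a≤n

  [+≟]≡0# : ∀ a s n x → n < a → [ a + s ≟ n ] x ≡ 0#
  [+≟]≡0# a s n x n<a = [≟]-≢ x (λ a+s≡n → ℕ.<⇒≱ n<a (ℕ.≤-trans (ℕ.m≤m+n a s) (ℕ.≤-reflexive a+s≡n)))

  [_<?_]_ : ℕ → ℕ → Carrier → Carrier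
  [ x <? b ] z = if does (x ℕ.<? b) then z else 0#

  [<?]-< : ∀ {x b} z → x < b → [ x <? b ] z ≡ z
  [<?]-< {x} {b} z x<b rewrite dec-true (x ℕ.<? b) x<b = ≡.refl

  [<?]-≥ : ∀ {x b} z → b ≤ x → [ x <? b ] z ≡ 0#
  [<?]-≥ {x} {b} z b≤x rewrite dec-false (x ℕ.<? b) (ℕ.≤⇒≯ b≤x) = ≡.refl

  sumTo-[≟] : ∀ N s (f : ℕ → Carrier) → s < N → ∑[ k < N ] [ s ≟ k ] f k ≈ f s
  sumTo-[≟] (suc N) zero    f _         = trans (+-congˡ (sumTo-≈0 N (λ _ _ → refl))) (+-identityʳ _)
  sumTo-[≟] (suc N) (suc s) f (s≤s s<N) = trans (+-identityˡ _) (sumTo-[≟] N s (f ∘ suc) s<N)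

  sumOver-sumTo-comm : ∀ xs n (f : A → ℕ → Carrier) →
                       ∑[ x ∈ xs ] sumTo n (f x) ≈ ∑[ i < n ] ∑[ x ∈ xs ] f x i
  sumOver-sumTo-comm xs n f = begin
    ∑[ x ∈ xs ] sumTo n (f x)             ≡⟨ ≡.cong sum (List.map-cong (λ x → sumTo≡sumOver-upTo n (f x)) xs) ⟩
    ∑[ x ∈ xs ] sumOver (upTo n) (f x)    ≈⟨ sumOver-comm xs (upTo n) f ⟩
    ∑[ i ∈ upTo n ] ∑[ x ∈ xs ] f x i      ≡⟨ sumTo≡sumOver-upTo n _ ⟨
    ∑[ i < n ] ∑[ x ∈ xs ] f x i           ∎

module ℕΣ = FiniteSums ℕ.+-*-commutativeSemiring
module ℕ* = CommSemigroupProperties ℕ.*-commutativeSemigroup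

-- A tuple js = (j₁, j₂, …) lists how many parts of each size 1, 2, … a partition has, so position p
-- holds j_(p+1); at reads 0 past the end.
at : ℕ → List ℕ → ℕ
at p       []       = 0
at zero    (j ∷ js) = j
at (suc p) (j ∷ js) = at p js

incAt : ℕ → List ℕ → List ℕ
incAt p       []       = []
incAt zero    (j ∷ js) = suc j ∷ js
incAt (suc p) (j ∷ js) = j ∷ incAt p js

decAt : ℕ → List ℕ → List ℕ
decAt p       []       = []
decAt zero    (j ∷ js) = pred j ∷ js
decAt (suc p) (j ∷ js) = j ∷ decAt p js

at-incAt : ∀ p js → p < length js → at p (incAt p js) ≡ suc (at p js)
at-incAt zero    (j ∷ js) _         = ≡.refl
at-incAt (suc p) (j ∷ js) (s≤s p<l) = at-incAt p js p<l

decAt-incAt : ∀ p js → decAt p (incAt p js) ≡ js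
decAt-incAt p       []       = ≡.refl
decAt-incAt zero    (j ∷ js) = ≡.refl
decAt-incAt (suc p) (j ∷ js) = ≡.cong (j ∷_) (decAt-incAt p js)

weightFrom-incAt : ∀ p i js → p < length js → weightFrom i (incAt p js) ≡ weightFrom i js + (i + p)
weightFrom-incAt zero    i (j ∷ js) _ =
  solve 3 (λ i j w → i :* (con 1 :+ j) :+ w := (i :* j :+ w) :+ (i :+ con 0)) ≡.refl i j (weightFrom (suc i) js)
  where open +-*-Solver
weightFrom-incAt (suc p) i (j ∷ js) (s≤s p<l) = begin
  i * j + weightFrom (suc i) (incAt p js)        ≡⟨ ≡.cong (i * j +_) (weightFrom-incAt p (suc i) js p<l) ⟩
  i * j + (weightFrom (suc i) js + (suc i + p))  ≡⟨ ℕ.+-assoc (i * j) _ _ ⟨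
  i * j + weightFrom (suc i) js + (suc i + p)    ≡⟨ ≡.cong (i * j + weightFrom (suc i) js +_) (ℕ.+-suc i p) ⟨
  i * j + weightFrom (suc i) js + (i + suc p)    ∎
  where open ≡.≡-Reasoning

at*≤weightFrom : ∀ p i js → at p js * (i + p) ≤ weightFrom i js
at*≤weightFrom p       i []       = z≤n
at*≤weightFrom zero    i (j ∷ js) =
  ℕ.≤-trans (ℕ.≤-reflexive (≡.trans (≡.cong (j *_) (ℕ.+-identityʳ i)) (ℕ.*-comm j i))) (ℕ.m≤m+n (i * j) _)
at*≤weightFrom (suc p) i (j ∷ js) = ℕ.≤-trans (ℕ.≤-reflexive (≡.cong (at p js *_) (ℕ.+-suc i p)))
                                      (ℕ.≤-trans (at*≤weightFrom p (suc i) js) (ℕ.m≤n+m _ (i * j)))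

sumℕ≤weightFrom : ∀ i js → sumℕ js ≤ weightFrom (suc i) js
sumℕ≤weightFrom i []       = z≤n
sumℕ≤weightFrom i (j ∷ js) = ℕ.+-mono-≤ (ℕ.m≤n*m j (suc i)) (sumℕ≤weightFrom (suc i) js)

sumℕ≡0⇒weightFrom≡0 : ∀ i js → sumℕ js ≡ 0 → weightFrom i js ≡ 0
sumℕ≡0⇒weightFrom≡0 i []       _ = ≡.refl
sumℕ≡0⇒weightFrom≡0 i (j ∷ js) e with ℕ.m+n≡0⇒m≡0 j e
... | ≡.refl = ≡.trans (≡.cong (_+ weightFrom (suc i) js) (ℕ.*-zeroʳ i)) (sumℕ≡0⇒weightFrom≡0 (suc i) js e)

sumℕ-decAt : ∀ p js a → at p js ≡ suc a → sumℕ js ≡ suc (sumℕ (decAt p js))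
sumℕ-decAt zero    (j ∷ js) a ≡.refl = ≡.refl
sumℕ-decAt (suc p) (j ∷ js) a e    = ≡.trans (≡.cong (j +_) (sumℕ-decAt p js a e)) (ℕ.+-suc j _)

factProd-decAt : ∀ p js a → at p js ≡ suc a → factProd js ≡ suc a * factProd (decAt p js)
factProd-decAt zero    (j ∷ js) a ≡.refl = ℕ.*-assoc (suc a) (a !) (factProd js)
factProd-decAt (suc p) (j ∷ js) a e    = begin
  j ! * factProd js                       ≡⟨ ≡.cong (j ! *_) (factProd-decAt p js a e) ⟩
  j ! * (suc a * factProd (decAt p js))   ≡⟨ ℕ*.x∙yz≈y∙xz (j !) (suc a) _ ⟩
  suc a * (j ! * factProd (decAt p js))   ∎
  where open ≡.≡-Reasoning

factProd∣sumℕ! : ∀ js → factProd js ∣ sumℕ js !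
factProd∣sumℕ! []       = ∣-refl
factProd∣sumℕ! (j ∷ js) = ∣-trans (*-monoʳ-∣ (j !) (factProd∣sumℕ! js))
  (≡.subst (λ t → j ! * t ! ∣ (j + sumℕ js) !) (ℕ.m+n∸m≡n j (sumℕ js)) (k![n∸k]!∣n! (ℕ.m≤m+n j (sumℕ js))))

multinomial : List ℕ → ℕ
multinomial js = multinom (sumℕ js) js

multinomial*factProd : ∀ js → multinomial js * factProd js ≡ sumℕ js !
multinomial*factProd js = m/n*n≡m {{factProd≢0 js}} (factProd∣sumℕ! js)

ifZero_then_else_ : ∀ {a} {A : Set a} → ℕ → A → A → A
ifZero zero  then x else y = x
ifZero suc _ then x else y = y

sumTo-at : ∀ js → ℕΣ.sumTo (length js) (λ p → at p js) ≡ sumℕ js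
sumTo-at []       = ≡.refl
sumTo-at (j ∷ js) = ≡.cong (j +_) (sumTo-at js)

-- Pascal's rule for multinomial coefficients; multiplied by factProd js it reads (s + 1)! = Σₚ jₚ · s!.
multinomial-pascal : ∀ js s → sumℕ js ≡ suc s →
  multinomial js ≡ ℕΣ.sumTo (length js) (λ p → ifZero at p js then 0 else multinomial (decAt p js))
multinomial-pascal js s sum≡1+s = ℕ.*-cancelʳ-≡ _ _ (factProd js) {{factProd≢0 js}} (begin
  multinomial js * factProd js                    ≡⟨ multinomial*factProd js ⟩
  sumℕ js !                                       ≡⟨ ≡.cong _! sum≡1+s ⟩
  suc s * s !                                     ≡⟨ ≡.cong (_* s !) (≡.trans (≡.sym sum≡1+s) (≡.sym (sumTo-at js))) ⟩
  ℕΣ.sumTo (length js) (λ p → at p js) * s !      ≡⟨ ℕΣ.*-distribʳ-sumTo (length js) (s !) _ ⟩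
  ℕΣ.sumTo (length js) (λ p → at p js * s !)      ≡⟨ ℕΣ.sumTo-cong (length js) (λ p _ → ≡.sym (term p)) ⟩
  ℕΣ.sumTo (length js) (λ p → g p * factProd js)  ≡⟨ ℕΣ.*-distribʳ-sumTo (length js) (factProd js) g ⟨
  ℕΣ.sumTo (length js) g * factProd js            ∎)
  where
  open ≡.≡-Reasoning
  g : ℕ → ℕ
  g p = ifZero at p js then 0 else multinomial (decAt p js)
  term : ∀ p → g p * factProd js ≡ at p js * s !
  term p with at p js in eq
  ... | zero  = ≡.refl
  ... | suc a = begin
    multinomial js′ * factProd js          ≡⟨ ≡.cong (multinomial js′ *_) (factProd-decAt p js a eq) ⟩
    multinomial js′ * (suc a * factProd js′) ≡⟨ ℕ*.x∙yz≈y∙xz (multinomial js′) (suc a) _ ⟩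
    suc a * (multinomial js′ * factProd js′) ≡⟨ ≡.cong (suc a *_) (multinomial*factProd js′) ⟩
    suc a * sumℕ js′ !                       ≡⟨ ≡.cong (λ t → suc a * t !) sumℕjs′≡s ⟩
    suc a * s !                              ∎
    where
    js′ : List ℕ
    js′ = decAt p js
    sumℕjs′≡s : sumℕ js′ ≡ s
    sumℕjs′≡s = ℕ.suc-injective (≡.trans (≡.sym (sumℕ-decAt p js a eq)) sum≡1+s)

sumℕ-++-zeros : ∀ js d → sumℕ (js ++ replicate d 0) ≡ sumℕ js
sumℕ-++-zeros []       zero    = ≡.refl
sumℕ-++-zeros []       (suc d) = sumℕ-++-zeros [] d
sumℕ-++-zeros (j ∷ js) d       = ≡.cong (j +_) (sumℕ-++-zeros js d)

factProd-++-zeros : ∀ js d → factProd (js ++ replicate d 0) ≡ factProd js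
factProd-++-zeros []       zero    = ≡.refl
factProd-++-zeros []       (suc d) = ≡.trans (ℕ.+-identityʳ _) (factProd-++-zeros [] d)
factProd-++-zeros (j ∷ js) d       = ≡.cong (j ! *_) (factProd-++-zeros js d)

multinomial-++-zeros : ∀ js d → multinomial (js ++ replicate d 0) ≡ multinomial js
multinomial-++-zeros js d =
  ≡.trans (≡.cong (λ k → multinom k (js ++ replicate d 0)) (sumℕ-++-zeros js d))
        (/-congʳ {{factProd≢0 (js ++ replicate d 0)}} {{factProd≢0 js}} (factProd-++-zeros js d))

[n∸i]+[1+r]*[1+i]≡1+n+[1+i]*r : ∀ n i r → i ≤ n → (n ∸ i) + suc r * suc i ≡ suc n + suc i * r
[n∸i]+[1+r]*[1+i]≡1+n+[1+i]*r n i r i≤n = begin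
  (n ∸ i) + (suc i + r * suc i)   ≡⟨ ℕ.+-assoc (n ∸ i) (suc i) _ ⟨
  (n ∸ i) + suc i + r * suc i     ≡⟨ ≡.cong₂ _+_ (ℕ.+-suc (n ∸ i) i) (ℕ.*-comm r (suc i)) ⟩
  suc (n ∸ i + i) + suc i * r     ≡⟨ ≡.cong (λ m → suc m + suc i * r) (ℕ.m∸n+n≡m i≤n) ⟩
  suc n + suc i * r               ∎
  where open ≡.≡-Reasoning

module Convolution {c ℓ} (S : CommutativeSemiring c ℓ) where
  open CommutativeSemiring S renaming (_+_ to _⊕_; _*_ to _·_)
  open FiniteSums S
  open import Algebra.Properties.Semiring.Mult semiring
    using (_×_; ×-congʳ; ×-homo-+; ×-assocˡ; ×-comm-*; ×-assoc-*)
  open import Algebra.Properties.CommutativeMonoid.Mult +-commutativeMonoid using (×-distrib-+)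
  open CommSemigroupProperties +-commutativeSemigroup
    using () renaming (interchange to +-interchange)
  open import Relation.Binary.Reasoning.Setoid setoid

  infixl 7 _⋆_
  infixr 8 _^⋆_

  _⋆_ : (ℕ → Carrier) → (ℕ → Carrier) → ℕ → Carrier
  (f ⋆ g) n = ∑[ i < suc n ] (f i · g (n ∸ i))

  δ : ℕ → Carrier
  δ n = [ 0 ≟ n ] 1#

  _^⋆_ : (ℕ → Carrier) → ℕ → ℕ → Carrier
  f ^⋆ zero  = δ
  f ^⋆ suc r = f ⋆ f ^⋆ r

  θ : (ℕ → Carrier) → ℕ → Carrier
  θ f n = n × f n

  ×-zeroʳ : ∀ m → m × 0# ≈ 0#
  ×-zeroʳ zero    = refl
  ×-zeroʳ (suc m) = trans (+-identityˡ _) (×-zeroʳ m)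

  ×-distrib-sumTo : ∀ m n f → m × sumTo n f ≈ ∑[ i < n ] (m × f i)
  ×-distrib-sumTo m zero    f = ×-zeroʳ m
  ×-distrib-sumTo m (suc n) f = trans (×-distrib-+ (f 0) (sumTo n (f ∘ suc)) m) (+-congˡ (×-distrib-sumTo m n (f ∘ suc)))

  ×-homo-sumTo : ∀ n (g : ℕ → ℕ) x → ℕΣ.sumTo n g × x ≈ ∑[ p < n ] (g p × x)
  ×-homo-sumTo zero    g x = refl
  ×-homo-sumTo (suc n) g x = trans (×-homo-+ x (g 0) _) (+-congˡ (×-homo-sumTo n (g ∘ suc) x))

  ⋆-cong : ∀ {f f′ g g′} → (∀ k → f k ≈ f′ k) → (∀ k → g k ≈ g′ k) →
           ∀ n → (f ⋆ g) n ≈ (f′ ⋆ g′) n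
  ⋆-cong f≈f′ g≈g′ n = sumTo-cong (suc n) (λ i _ → *-cong (f≈f′ i) (g≈g′ (n ∸ i)))

  ⋆-congˡ : ∀ f {g g′} → (∀ k → g k ≈ g′ k) → ∀ n → (f ⋆ g) n ≈ (f ⋆ g′) n
  ⋆-congˡ f = ⋆-cong {f} {f} (λ _ → refl)

  ⋆-congʳ : ∀ {f f′} g → (∀ k → f k ≈ f′ k) → ∀ n → (f ⋆ g) n ≈ (f′ ⋆ g) n
  ⋆-congʳ g f≈f′ = ⋆-cong f≈f′ (λ _ → refl)

  ⋆-distribʳ-⊕ : ∀ f g h n → ((λ k → f k ⊕ g k) ⋆ h) n ≈ (f ⋆ h) n ⊕ (g ⋆ h) n
  ⋆-distribʳ-⊕ f g h n = trans (sumTo-cong (suc n) (λ i _ → distribʳ (h (n ∸ i)) (f i) (g i)))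
                                (sumTo-distrib-⊕ (suc n) (λ i → f i · h (n ∸ i)) (λ i → g i · h (n ∸ i)))

  ⋆-distribˡ-⊕ : ∀ f g h n → (f ⋆ (λ k → g k ⊕ h k)) n ≈ (f ⋆ g) n ⊕ (f ⋆ h) n
  ⋆-distribˡ-⊕ f g h n = trans (sumTo-cong (suc n) (λ i _ → distribˡ (f i) (g (n ∸ i)) (h (n ∸ i))))
                                (sumTo-distrib-⊕ (suc n) (λ i → f i · g (n ∸ i)) (λ i → f i · h (n ∸ i)))

  ⋆-×ʳ : ∀ m f g n → (f ⋆ (λ k → m × g k)) n ≈ m × (f ⋆ g) n
  ⋆-×ʳ m f g n = trans (sumTo-cong (suc n) (λ i _ → ×-comm-* m (f i) (g (n ∸ i))))
                        (sym (×-distrib-sumTo m (suc n) (λ i → f i · g (n ∸ i))))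

  ⋆-comm : ∀ f g n → (f ⋆ g) n ≈ (g ⋆ f) n
  ⋆-comm f g n = trans (sumTo-reverse (suc n) (λ i → f i · g (n ∸ i)))
    (sumTo-cong (suc n) {λ i → f (n ∸ i) · g (n ∸ (n ∸ i))} (λ i i≤n → trans (*-comm _ _)
      (*-congʳ (reflexive (≡.cong g (ℕ.m∸[m∸n]≡n (ℕ.≤-pred i≤n)))))))

  sumTo-triangle : ∀ n (F : ℕ → ℕ → Carrier) →
    ∑[ k < suc n ] ∑[ i < suc k ] F i k ≈ ∑[ i < suc n ] ∑[ j < suc (n ∸ i) ] F i (i + j)
  sumTo-triangle zero    F = refl
  sumTo-triangle (suc n) F = begin
    (F 0 0 ⊕ 0#) ⊕ ∑[ k < suc n ] (F 0 (suc k) ⊕ ∑[ i < suc k ] F (suc i) (suc k))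
      ≈⟨ +-cong (+-identityʳ _) (sumTo-distrib-⊕ (suc n) (λ k → F 0 (suc k)) (λ k → ∑[ i < suc k ] F (suc i) (suc k))) ⟩
    F 0 0 ⊕ (∑[ k < suc n ] F 0 (suc k) ⊕ ∑[ k < suc n ] ∑[ i < suc k ] F (suc i) (suc k))
      ≈⟨ +-assoc _ _ _ ⟨
    (F 0 0 ⊕ ∑[ k < suc n ] F 0 (suc k)) ⊕ ∑[ k < suc n ] ∑[ i < suc k ] F (suc i) (suc k)
      ≈⟨ +-congˡ (sumTo-triangle n (λ i k → F (suc i) (suc k))) ⟩
    (F 0 0 ⊕ ∑[ k < suc n ] F 0 (suc k)) ⊕ ∑[ i < suc n ] ∑[ j < suc (n ∸ i) ] F (suc i) (suc (i + j)) ∎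

  ⋆-assoc : ∀ f g h n → (f ⋆ (g ⋆ h)) n ≈ (f ⋆ g ⋆ h) n
  ⋆-assoc f g h n = begin
    (f ⋆ (g ⋆ h)) n                                  ≈⟨ sumTo-cong (suc n) (λ i _ → row i) ⟩
    ∑[ i < suc n ] ∑[ j < suc (n ∸ i) ] F i (i + j)   ≈⟨ sumTo-triangle n F ⟨
    ∑[ k < suc n ] ∑[ i < suc k ] F i k               ≈⟨ sumTo-cong (suc n) (λ k _ → column k) ⟩
    (f ⋆ g ⋆ h) n                                    ∎
    where
    F : ℕ → ℕ → Carrier
    F i k = f i · (g (k ∸ i) · h (n ∸ k))

    row : ∀ i → f i · (g ⋆ h) (n ∸ i) ≈ ∑[ j < suc (n ∸ i) ] F i (i + j)
    row i = trans (*-distribˡ-sumTo (suc (n ∸ i)) (f i) (λ j → g j · h (n ∸ i ∸ j)))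
      (sumTo-cong (suc (n ∸ i)) {g = λ j → F i (i + j)} (λ j _ → *-congˡ (*-cong
         (reflexive (≡.cong g (≡.sym (ℕ.m+n∸m≡n i j))))
         (reflexive (≡.cong h (ℕ.∸-+-assoc n i j))))))

    column : ∀ k → ∑[ i < suc k ] F i k ≈ (f ⋆ g) k · h (n ∸ k)
    column k = trans (sumTo-cong (suc k) {g = λ i → (f i · g (k ∸ i)) · h (n ∸ k)} (λ i _ → sym (*-assoc _ _ _)))
                     (sym (*-distribʳ-sumTo (suc k) (h (n ∸ k)) (λ i → f i · g (k ∸ i))))

  ⋆-⋆-comm : ∀ f g h n → (f ⋆ (g ⋆ h)) n ≈ (g ⋆ (f ⋆ h)) n
  ⋆-⋆-comm f g h n = begin
    (f ⋆ (g ⋆ h)) n ≈⟨ ⋆-assoc f g h n ⟩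
    (f ⋆ g ⋆ h) n   ≈⟨ ⋆-congʳ h (⋆-comm f g) n ⟩
    (g ⋆ f ⋆ h) n   ≈⟨ ⋆-assoc g f h n ⟨
    (g ⋆ (f ⋆ h)) n ∎

  θ-⋆ : ∀ f g n → θ (f ⋆ g) n ≈ (θ f ⋆ g) n ⊕ (f ⋆ θ g) n
  θ-⋆ f g n = begin
    n × (f ⋆ g) n                                    ≈⟨ ×-distrib-sumTo n (suc n) (λ i → f i · g (n ∸ i)) ⟩
    ∑[ i < suc n ] (n × (f i · g (n ∸ i)))           ≈⟨ sumTo-cong (suc n) (λ i i<1+n → split i (ℕ.≤-pred i<1+n)) ⟩
    ∑[ i < suc n ] ((i × f i) · g (n ∸ i) ⊕ f i · ((n ∸ i) × g (n ∸ i)))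
                                                     ≈⟨ sumTo-distrib-⊕ (suc n) (λ i → (i × f i) · g (n ∸ i))
                                                                         (λ i → f i · ((n ∸ i) × g (n ∸ i))) ⟩
    (θ f ⋆ g) n ⊕ (f ⋆ θ g) n                        ∎
    where
    split : ∀ i → i ≤ n → n × (f i · g (n ∸ i)) ≈ (i × f i) · g (n ∸ i) ⊕ f i · ((n ∸ i) × g (n ∸ i))
    split i i≤n = begin
      n × (f i · g (n ∸ i))                                 ≡⟨ ≡.cong (_× (f i · g (n ∸ i))) (ℕ.m+[n∸m]≡n i≤n) ⟨
      (i + (n ∸ i)) × (f i · g (n ∸ i))                     ≈⟨ ×-homo-+ (f i · g (n ∸ i)) i (n ∸ i) ⟩
      i × (f i · g (n ∸ i)) ⊕ (n ∸ i) × (f i · g (n ∸ i))   ≈⟨ +-cong (sym (×-assoc-* i (f i) (g (n ∸ i))))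
                                                                      (sym (×-comm-* (n ∸ i) (f i) (g (n ∸ i)))) ⟩
      (i × f i) · g (n ∸ i) ⊕ f i · ((n ∸ i) × g (n ∸ i))   ∎

  ⋆-suc : ∀ g f → g 0 ≈ 0# → ∀ n → (g ⋆ f) (suc n) ≈ ∑[ i < suc n ] (g (suc i) · f (n ∸ i))
  ⋆-suc g f g0≈0 n = trans (+-congʳ (trans (*-congʳ g0≈0) (zeroˡ _))) (+-identityˡ _)

  θδ≈0 : ∀ n → θ δ n ≈ 0#
  θδ≈0 zero    = refl
  θδ≈0 (suc n) = ×-zeroʳ (suc n)

  module Reciprocal (C Y : ℕ → Carrier) (Y≈δ⊕C⋆Y : ∀ n → Y n ≈ δ n ⊕ (C ⋆ Y) n) where

    θY : ∀ n → θ Y n ≈ (θ C ⋆ Y) n ⊕ (C ⋆ θ Y) n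
    θY n = begin
      n × Y n                ≈⟨ ×-congʳ n (Y≈δ⊕C⋆Y n) ⟩
      n × (δ n ⊕ (C ⋆ Y) n)  ≈⟨ ×-distrib-+ (δ n) ((C ⋆ Y) n) n ⟩
      θ δ n ⊕ θ (C ⋆ Y) n    ≈⟨ trans (+-congʳ (θδ≈0 n)) (+-identityˡ _) ⟩
      θ (C ⋆ Y) n            ≈⟨ θ-⋆ C Y n ⟩
      (θ C ⋆ Y) n ⊕ (C ⋆ θ Y) n ∎

    -- For Y = 1/(1 - C): θ(Y^r) = r Y^(r-1) θY and (1 - C) θY = θC Y, so (1 - C) θ(Y^r) = r θC Y^r.
    θ-^⋆ : ∀ r n → θ (Y ^⋆ r) n ≈ (C ⋆ θ (Y ^⋆ r)) n ⊕ r × (θ C ⋆ Y ^⋆ r) n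
    θ-^⋆ zero    n = trans (θδ≈0 n) (sym (trans (+-identityʳ _)
      (sumTo-≈0 (suc n) (λ i _ → trans (*-congˡ (θδ≈0 (n ∸ i))) (zeroʳ (C i))))))
    θ-^⋆ (suc r) n = begin
      θ (Y ⋆ P) n
        ≈⟨ θ-⋆ Y P n ⟩
      (θ Y ⋆ P) n ⊕ (Y ⋆ θ P) n
        ≈⟨ +-cong left right ⟩
      ((θ C ⋆ P′) n ⊕ (C ⋆ (θ Y ⋆ P)) n) ⊕ ((C ⋆ (Y ⋆ θ P)) n ⊕ r × (θ C ⋆ P′) n)
        ≈⟨ +-congʳ (+-comm _ _) ⟩
      ((C ⋆ (θ Y ⋆ P)) n ⊕ (θ C ⋆ P′) n) ⊕ ((C ⋆ (Y ⋆ θ P)) n ⊕ r × (θ C ⋆ P′) n)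
        ≈⟨ +-interchange _ _ _ _ ⟩
      ((C ⋆ (θ Y ⋆ P)) n ⊕ (C ⋆ (Y ⋆ θ P)) n) ⊕ suc r × (θ C ⋆ P′) n
        ≈⟨ +-congʳ (⋆-distribˡ-⊕ C (θ Y ⋆ P) (Y ⋆ θ P) n) ⟨
      (C ⋆ (λ k → (θ Y ⋆ P) k ⊕ (Y ⋆ θ P) k)) n ⊕ suc r × (θ C ⋆ P′) n
        ≈⟨ +-congʳ (⋆-congˡ C (θ-⋆ Y P) n) ⟨
      (C ⋆ θ P′) n ⊕ suc r × (θ C ⋆ P′) n ∎
      where
      P P′ : ℕ → Carrier
      P  = Y ^⋆ r
      P′ = Y ^⋆ suc r

      left : (θ Y ⋆ P) n ≈ (θ C ⋆ P′) n ⊕ (C ⋆ (θ Y ⋆ P)) n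
      left = begin
        (θ Y ⋆ P) n
          ≈⟨ ⋆-congʳ P θY n ⟩
        ((λ k → (θ C ⋆ Y) k ⊕ (C ⋆ θ Y) k) ⋆ P) n
          ≈⟨ ⋆-distribʳ-⊕ (θ C ⋆ Y) (C ⋆ θ Y) P n ⟩
        (θ C ⋆ Y ⋆ P) n ⊕ (C ⋆ θ Y ⋆ P) n
          ≈⟨ +-cong (⋆-assoc (θ C) Y P n) (⋆-assoc C (θ Y) P n) ⟨
        (θ C ⋆ P′) n ⊕ (C ⋆ (θ Y ⋆ P)) n ∎

      right : (Y ⋆ θ P) n ≈ (C ⋆ (Y ⋆ θ P)) n ⊕ r × (θ C ⋆ P′) n
      right = begin
        (Y ⋆ θ P) n
          ≈⟨ ⋆-congˡ Y (θ-^⋆ r) n ⟩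
        (Y ⋆ (λ k → (C ⋆ θ P) k ⊕ r × (θ C ⋆ P) k)) n
          ≈⟨ ⋆-distribˡ-⊕ Y (C ⋆ θ P) (λ k → r × (θ C ⋆ P) k) n ⟩
        (Y ⋆ (C ⋆ θ P)) n ⊕ (Y ⋆ (λ k → r × (θ C ⋆ P) k)) n
          ≈⟨ +-cong (⋆-⋆-comm Y C (θ P) n) (⋆-×ʳ r Y (θ C ⋆ P) n) ⟩
        (C ⋆ (Y ⋆ θ P)) n ⊕ r × (Y ⋆ (θ C ⋆ P)) n
          ≈⟨ +-congˡ (×-congʳ r (⋆-⋆-comm Y (θ C) P n)) ⟩
        (C ⋆ (Y ⋆ θ P)) n ⊕ r × (θ C ⋆ P′) n ∎

    ^⋆-recurrence : C 0 ≈ 0# → ∀ r n →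
      suc n × (Y ^⋆ suc r) (suc n) ≈ ∑[ i < suc n ] ((suc n + suc i * r) × (C (suc i) · (Y ^⋆ suc r) (n ∸ i)))
    ^⋆-recurrence C0≈0 r n = begin
      θ P (suc n)
        ≈⟨ θ-^⋆ (suc r) (suc n) ⟩
      (C ⋆ θ P) (suc n) ⊕ suc r × (θ C ⋆ P) (suc n)
        ≈⟨ +-cong (⋆-suc C (θ P) C0≈0 n) (×-congʳ (suc r) (⋆-suc (θ C) P refl n)) ⟩
      ∑[ i < suc n ] (C (suc i) · θ P (n ∸ i)) ⊕ suc r × ∑[ i < suc n ] (θ C (suc i) · P (n ∸ i))
        ≈⟨ +-cong (sumTo-cong (suc n) (λ i _ → ×-comm-* (n ∸ i) (C (suc i)) (P (n ∸ i))))
                  (×-congʳ (suc r) (sumTo-cong (suc n) (λ i _ → ×-assoc-* (suc i) (C (suc i)) (P (n ∸ i))))) ⟩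
      ∑[ i < suc n ] ((n ∸ i) × X i) ⊕ suc r × ∑[ i < suc n ] (suc i × X i)
        ≈⟨ +-congˡ (×-distrib-sumTo (suc r) (suc n) (λ i → suc i × X i)) ⟩
      ∑[ i < suc n ] ((n ∸ i) × X i) ⊕ ∑[ i < suc n ] (suc r × (suc i × X i))
        ≈⟨ sumTo-distrib-⊕ (suc n) (λ i → (n ∸ i) × X i) (λ i → suc r × (suc i × X i)) ⟨
      ∑[ i < suc n ] ((n ∸ i) × X i ⊕ suc r × (suc i × X i))
        ≈⟨ sumTo-cong (suc n) (λ i i<1+n → combine i (ℕ.≤-pred i<1+n)) ⟩
      ∑[ i < suc n ] ((suc n + suc i * r) × X i) ∎
      where
      P : ℕ → Carrier
      P = Y ^⋆ suc r

      X : ℕ → Carrier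
      X i = C (suc i) · P (n ∸ i)

      combine : ∀ i → i ≤ n → (n ∸ i) × X i ⊕ suc r × (suc i × X i) ≈ (suc n + suc i * r) × X i
      combine i i≤n = begin
        (n ∸ i) × X i ⊕ suc r × (suc i × X i)   ≈⟨ +-congˡ (×-assocˡ (X i) (suc r) (suc i)) ⟩
        (n ∸ i) × X i ⊕ (suc r * suc i) × X i   ≈⟨ ×-homo-+ (X i) (n ∸ i) (suc r * suc i) ⟨
        ((n ∸ i) + suc r * suc i) × X i         ≡⟨ ≡.cong (_× X i) ([n∸i]+[1+r]*[1+i]≡1+n+[1+i]*r n i r i≤n) ⟩
        (suc n + suc i * r) × X i               ∎

tuples : ℕ → ℕ → List (List ℕ)
tuples l b = map toList (boundedVecs l b)

module TupleSums {c ℓ} (S : CommutativeSemiring c ℓ) where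
  open CommutativeSemiring S renaming (_+_ to _⊕_; _*_ to _·_)
  open FiniteSums S
  open Convolution S using (_^⋆_)
  open import Relation.Binary.Reasoning.Setoid setoid

  sumOver-tuples-suc : ∀ l b F →
                       ∑[ js ∈ tuples (suc l) b ] F js ≈ ∑[ j < suc b ] ∑[ js ∈ tuples l b ] F (j ∷ js)
  sumOver-tuples-suc l b F = begin
    sumOver (map toList (concatMap consAll (upTo (suc b)))) F
      ≡⟨ sumOver-map (concatMap consAll (upTo (suc b))) toList F ⟩
    sumOver (concatMap consAll (upTo (suc b))) (F ∘ toList)
      ≈⟨ sumOver-concatMap (upTo (suc b)) consAll (F ∘ toList) ⟩
    ∑[ j ∈ upTo (suc b) ] sumOver (consAll j) (F ∘ toList)
      ≈⟨ sumOver-cong (upTo (suc b)) (λ j → reflexive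
           (≡.trans (sumOver-map (boundedVecs l b) (j ∷ᵥ_) (F ∘ toList))
                    (≡.sym (sumOver-map (boundedVecs l b) toList (λ js → F (j ∷ js)))))) ⟩
    ∑[ j ∈ upTo (suc b) ] ∑[ js ∈ tuples l b ] F (j ∷ js)
      ≡⟨ sumTo≡sumOver-upTo (suc b) _ ⟨
    ∑[ j < suc b ] ∑[ js ∈ tuples l b ] F (j ∷ js) ∎
    where
    consAll : ℕ → List (Vec ℕ (suc l))
    consAll j = map (j ∷ᵥ_) (boundedVecs l b)

  sumOver-tuples-cong : ∀ l b {F G : List ℕ → Carrier} → (∀ js → length js ≡ l → F js ≈ G js) →
                        sumOver (tuples l b) F ≈ sumOver (tuples l b) G
  sumOver-tuples-cong zero    b F≈G = +-congʳ (F≈G [] ≡.refl)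
  sumOver-tuples-cong (suc l) b {F} {G} F≈G = begin
    sumOver (tuples (suc l) b) F                    ≈⟨ sumOver-tuples-suc l b F ⟩
    ∑[ j < suc b ] ∑[ js ∈ tuples l b ] F (j ∷ js)  ≈⟨ sumTo-cong (suc b) (λ j _ →
                                                         sumOver-tuples-cong l b (λ js e → F≈G (j ∷ js) (≡.cong suc e))) ⟩
    ∑[ j < suc b ] ∑[ js ∈ tuples l b ] G (j ∷ js)  ≈⟨ sumOver-tuples-suc l b G ⟨
    sumOver (tuples (suc l) b) G                    ∎

  -- Reindexing by js ↦ incAt p js: a tuple with a positive p-th entry is the image of exactly one
  -- tuple, whose p-th entry is then < b.
  sumOver-tuples-incAt : ∀ l b p (F : List ℕ → Carrier) → p < l → (∀ js → at p js ≡ 0 → F js ≈ 0#) →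
                         sumOver (tuples l b) F ≈ ∑[ js ∈ tuples l b ] [ at p js <? b ] F (incAt p js)
  sumOver-tuples-incAt (suc l) b zero F _ F≈0 = begin
    sumOver (tuples (suc l) b) F
      ≈⟨ sumOver-tuples-suc l b F ⟩
    ∑[ js ∈ tuples l b ] F (0 ∷ js) ⊕ ∑[ j < b ] ∑[ js ∈ tuples l b ] F (suc j ∷ js)
      ≈⟨ trans (+-congʳ (sumOver-≈0 (tuples l b) (λ js → F≈0 (0 ∷ js) ≡.refl))) (+-identityˡ _) ⟩
    ∑[ j < b ] ∑[ js ∈ tuples l b ] F (suc j ∷ js)
      ≈⟨ sumTo-cong b (λ j j<b → sumOver-cong (tuples l b) (λ js → reflexive (≡.sym ([<?]-< _ j<b)))) ⟩
    ∑[ j < b ] ∑[ js ∈ tuples l b ] [ j <? b ] F (suc j ∷ js)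
      ≈⟨ trans (+-congˡ (sumOver-≈0 (tuples l b) (λ js → reflexive ([<?]-≥ {b} (F (suc b ∷ js)) ℕ.≤-refl))))
               (+-identityʳ _) ⟨
    ∑[ j < b ] ∑[ js ∈ tuples l b ] [ j <? b ] F (suc j ∷ js) ⊕ ∑[ js ∈ tuples l b ] [ b <? b ] F (suc b ∷ js)
      ≈⟨ sumTo-last b (λ j → ∑[ js ∈ tuples l b ] [ j <? b ] F (suc j ∷ js)) ⟨
    ∑[ j < suc b ] ∑[ js ∈ tuples l b ] [ j <? b ] F (suc j ∷ js)
      ≈⟨ sumOver-tuples-suc l b _ ⟨
    ∑[ js ∈ tuples (suc l) b ] [ at 0 js <? b ] F (incAt 0 js) ∎
  sumOver-tuples-incAt (suc l) b (suc p) F (s≤s p<l) F≈0 = begin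
    sumOver (tuples (suc l) b) F
      ≈⟨ sumOver-tuples-suc l b F ⟩
    ∑[ j < suc b ] ∑[ js ∈ tuples l b ] F (j ∷ js)
      ≈⟨ sumTo-cong (suc b) (λ j _ → sumOver-tuples-incAt l b p (λ js → F (j ∷ js)) p<l (λ js → F≈0 (j ∷ js))) ⟩
    ∑[ j < suc b ] ∑[ js ∈ tuples l b ] [ at p js <? b ] F (j ∷ incAt p js)
      ≈⟨ sumOver-tuples-suc l b _ ⟨
    ∑[ js ∈ tuples (suc l) b ] [ at (suc p) js <? b ] F (incAt (suc p) js) ∎

  -- The bound is irrelevant once the weight w is fixed, since an entry j contributes at least j to the weight.
  sumOver-tuples-weight-bound : ∀ l i w b b′ (F : List ℕ → Carrier) → w ≤ b → w ≤ b′ →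
    ∑[ js ∈ tuples l b ] [ weightFrom (suc i) js ≟ w ] F js
      ≈ ∑[ js ∈ tuples l b′ ] [ weightFrom (suc i) js ≟ w ] F js
  sumOver-tuples-weight-bound zero    i w b b′ F _ _ = refl
  sumOver-tuples-weight-bound (suc l) i w b b′ F w≤b w≤b′ = begin
    sumOver (tuples (suc l) b) G    ≈⟨ sumOver-tuples-suc l b G ⟩
    sumTo (suc b) (first b)         ≈⟨ sumTo-truncate w (suc b) (first b) (s≤s w≤b) (first-vanishes b) ⟩
    sumTo (suc w) (first b)         ≈⟨ sumTo-cong (suc w) (λ j _ → first-bound j) ⟩
    sumTo (suc w) (first b′)        ≈⟨ sumTo-truncate w (suc b′) (first b′) (s≤s w≤b′) (first-vanishes b′) ⟨
    sumTo (suc b′) (first b′)       ≈⟨ sumOver-tuples-suc l b′ G ⟨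
    sumOver (tuples (suc l) b′) G   ∎
    where
    G : List ℕ → Carrier
    G js = [ weightFrom (suc i) js ≟ w ] F js

    first : ℕ → ℕ → Carrier
    first B j = ∑[ js ∈ tuples l B ] [ suc i * j + weightFrom (suc (suc i)) js ≟ w ] F (j ∷ js)

    too-heavy : ∀ B j → w < suc i * j → first B j ≈ 0#
    too-heavy B j w<ij = sumOver-≈0 (tuples l B) (λ js → reflexive ([+≟]≡0# (suc i * j) _ w _ w<ij))

    first-vanishes : ∀ B j → w < j → first B j ≈ 0#
    first-vanishes B j w<j = too-heavy B j (ℕ.<-≤-trans w<j (ℕ.m≤n*m j (suc i)))

    first-bound : ∀ j → first b j ≈ first b′ j
    first-bound j with suc i * j ℕ.≤? w
    ... | no  ij≰w = trans (too-heavy b j (ℕ.≰⇒> ij≰w)) (sym (too-heavy b′ j (ℕ.≰⇒> ij≰w)))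
    ... | yes ij≤w = begin
      first b j
        ≈⟨ sumOver-cong (tuples l b) (λ js → reflexive ([+≟]≡[≟∸] (suc i * j) _ w _ ij≤w)) ⟩
      ∑[ js ∈ tuples l b ] [ weightFrom (suc (suc i)) js ≟ w ∸ suc i * j ] F (j ∷ js)
        ≈⟨ sumOver-tuples-weight-bound l (suc i) (w ∸ suc i * j) b b′ (λ js → F (j ∷ js))
             (ℕ.≤-trans (ℕ.m∸n≤m w (suc i * j)) w≤b) (ℕ.≤-trans (ℕ.m∸n≤m w (suc i * j)) w≤b′) ⟩
      ∑[ js ∈ tuples l b′ ] [ weightFrom (suc (suc i)) js ≟ w ∸ suc i * j ] F (j ∷ js)
        ≈⟨ sumOver-cong (tuples l b′) (λ js → reflexive ([+≟]≡[≟∸] (suc i * j) _ w _ ij≤w)) ⟨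
      first b′ j ∎

  sumOver-tuples-weight-< : ∀ d i w b (F : List ℕ → Carrier) → w < i →
    ∑[ js ∈ tuples d b ] [ weightFrom i js ≟ w ] F js ≈ [ 0 ≟ w ] F (replicate d 0)
  sumOver-tuples-weight-< zero    i w b F _   = +-identityʳ _
  sumOver-tuples-weight-< (suc d) i w b F w<i = begin
    ∑[ js ∈ tuples (suc d) b ] [ weightFrom i js ≟ w ] F js
      ≈⟨ sumOver-tuples-suc d b _ ⟩
    ∑[ js ∈ tuples d b ] [ i * 0 + weightFrom (suc i) js ≟ w ] F (0 ∷ js)
      ⊕ ∑[ j < b ] ∑[ js ∈ tuples d b ] [ i * suc j + weightFrom (suc i) js ≟ w ] F (suc j ∷ js)
      ≈⟨ +-cong (sumOver-cong (tuples d b) (λ js →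
                  reflexive (≡.cong (λ t → [ t + weightFrom (suc i) js ≟ w ] F (0 ∷ js)) (ℕ.*-zeroʳ i))))
                (sumTo-≈0 b (λ j _ → sumOver-≈0 (tuples d b) (λ js →
                  reflexive ([+≟]≡0# (i * suc j) _ w _ (ℕ.<-≤-trans w<i (ℕ.m≤m*n i (suc j))))))) ⟩
    ∑[ js ∈ tuples d b ] [ weightFrom (suc i) js ≟ w ] F (0 ∷ js) ⊕ 0#
      ≈⟨ +-identityʳ _ ⟩
    ∑[ js ∈ tuples d b ] [ weightFrom (suc i) js ≟ w ] F (0 ∷ js)
      ≈⟨ sumOver-tuples-weight-< d (suc i) w b (λ js → F (0 ∷ js)) (ℕ.m<n⇒m<1+n w<i) ⟩
    [ 0 ≟ w ] F (replicate (suc d) 0) ∎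

  -- Entries past position l would weigh more than w, so only zero padding contributes.
  sumOver-tuples-weight-++-zeros : ∀ l d i w b (F : List ℕ → Carrier) → w < i + l →
    ∑[ js ∈ tuples (l + d) b ] [ weightFrom i js ≟ w ] F js
      ≈ ∑[ js ∈ tuples l b ] [ weightFrom i js ≟ w ] F (js ++ replicate d 0)
  sumOver-tuples-weight-++-zeros zero    d i w b F w<i+0 =
    trans (sumOver-tuples-weight-< d i w b F (≡.subst (w <_) (ℕ.+-identityʳ i) w<i+0)) (sym (+-identityʳ _))
  sumOver-tuples-weight-++-zeros (suc l) d i w b F w<i+1+l =
    trans (sumOver-tuples-suc (l + d) b _) (trans (sumTo-cong (suc b) (λ j _ → first j)) (sym (sumOver-tuples-suc l b _)))
    where
    first : ∀ j → ∑[ js ∈ tuples (l + d) b ] [ i * j + weightFrom (suc i) js ≟ w ] F (j ∷ js)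
                ≈ ∑[ js ∈ tuples l b ] [ i * j + weightFrom (suc i) js ≟ w ] F (j ∷ (js ++ replicate d 0))
    first j with i * j ℕ.≤? w
    ... | no  ij≰w = trans (sumOver-≈0 (tuples (l + d) b) (λ js → reflexive ([+≟]≡0# (i * j) _ w _ (ℕ.≰⇒> ij≰w))))
                     (sym (sumOver-≈0 (tuples l b) (λ js → reflexive ([+≟]≡0# (i * j) _ w _ (ℕ.≰⇒> ij≰w)))))
    ... | yes ij≤w = begin
      ∑[ js ∈ tuples (l + d) b ] [ i * j + weightFrom (suc i) js ≟ w ] F (j ∷ js)
        ≈⟨ sumOver-cong (tuples (l + d) b) (λ js → reflexive ([+≟]≡[≟∸] (i * j) _ w _ ij≤w)) ⟩
      ∑[ js ∈ tuples (l + d) b ] [ weightFrom (suc i) js ≟ w ∸ i * j ] F (j ∷ js)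
        ≈⟨ sumOver-tuples-weight-++-zeros l d (suc i) (w ∸ i * j) b (λ js → F (j ∷ js))
             (ℕ.≤-<-trans (ℕ.m∸n≤m w (i * j)) (≡.subst (w <_) (ℕ.+-suc i l) w<i+1+l)) ⟩
      ∑[ js ∈ tuples l b ] [ weightFrom (suc i) js ≟ w ∸ i * j ] F (j ∷ (js ++ replicate d 0))
        ≈⟨ sumOver-cong (tuples l b) (λ js → reflexive ([+≟]≡[≟∸] (i * j) _ w _ ij≤w)) ⟨
      ∑[ js ∈ tuples l b ] [ i * j + weightFrom (suc i) js ≟ w ] F (j ∷ (js ++ replicate d 0)) ∎

  sumOver-tuples-sumℕ≈^⋆ : ∀ (f : ℕ → Carrier) r b n → n ≤ b →
    ∑[ ms ∈ tuples r b ] [ sumℕ ms ≟ n ] product (map f ms) ≈ (f ^⋆ r) n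
  sumOver-tuples-sumℕ≈^⋆ f zero    b n _   = +-identityʳ _
  sumOver-tuples-sumℕ≈^⋆ f (suc r) b n n≤b = begin
    ∑[ ms ∈ tuples (suc r) b ] [ sumℕ ms ≟ n ] product (map f ms) ≈⟨ sumOver-tuples-suc r b _ ⟩
    sumTo (suc b) first                                          ≈⟨ sumTo-truncate n (suc b) first (s≤s n≤b) too-big ⟩
    sumTo (suc n) first                                          ≈⟨ sumTo-cong (suc n) (λ m m<1+n → first≈ m (ℕ.≤-pred m<1+n)) ⟩
    (f ^⋆ suc r) n                                               ∎
    where
    first : ℕ → Carrier
    first m = ∑[ ms ∈ tuples r b ] [ m + sumℕ ms ≟ n ] (f m · product (map f ms))

    too-big : ∀ m → n < m → first m ≈ 0#
    too-big m n<m = sumOver-≈0 (tuples r b) (λ ms → reflexive ([+≟]≡0# m (sumℕ ms) n _ n<m))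

    first≈ : ∀ m → m ≤ n → first m ≈ f m · (f ^⋆ r) (n ∸ m)
    first≈ m m≤n = begin
      first m
        ≈⟨ sumOver-cong (tuples r b) (λ ms → trans (reflexive ([+≟]≡[≟∸] m (sumℕ ms) n _ m≤n))
                                                  ([≟]-*ˡ (sumℕ ms) (n ∸ m) (f m) (product (map f ms)))) ⟩
      ∑[ ms ∈ tuples r b ] (f m · [ sumℕ ms ≟ n ∸ m ] product (map f ms))
        ≈⟨ *-distribˡ-sumOver (tuples r b) (f m) _ ⟨
      f m · ∑[ ms ∈ tuples r b ] [ sumℕ ms ≟ n ∸ m ] product (map f ms)
        ≈⟨ *-congˡ (sumOver-tuples-sumℕ≈^⋆ f r b (n ∸ m) (ℕ.≤-trans (ℕ.m∸n≤m n m) n≤b)) ⟩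
      f m · (f ^⋆ r) (n ∸ m) ∎

module BellSums {a ℓ} (R : CommutativeRing a ℓ) (c : ℕ → CommutativeRing.Carrier R) where
  open CommutativeRing R renaming (_+_ to _⊕_; _*_ to _·_)
  open Seq R using (y; yPow; bellNorm; monoFrom)
  open FiniteSums commutativeSemiring
  open TupleSums commutativeSemiring
  open Convolution commutativeSemiring using (_⋆_; _^⋆_; δ; ⋆-suc; ×-homo-sumTo)
  open import Algebra.Properties.Semiring.Mult semiring using (_×_; ×-cong; ×-congʳ; ×-comm-*)
  open CommSemigroupProperties *-commutativeSemigroup using (x∙yz≈y∙xz)
  open import Relation.Binary.Reasoning.Setoid setoid

  term : List ℕ → Carrier
  term js = multinomial js × monoFrom c 1 js

  -- y n with the sum over k absorbed: a tuple contributes only to k = sumℕ js.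
  bellSum : ℕ → Carrier
  bellSum n = ∑[ js ∈ tuples n n ] [ weightFrom 1 js ≟ n ] term js

  -- The summand of Pascal's rule in which the removed element lies in a part of size p + 1.
  peel : ℕ → List ℕ → Carrier
  peel p js = ifZero at p js then 0# else (c (suc p) · term (decAt p js))

  monoFrom-decAt : ∀ p i js a → at p js ≡ suc a → monoFrom c i js ≈ c (i + p) · monoFrom c i (decAt p js)
  monoFrom-decAt zero    i (j ∷ js) a ≡.refl =
    trans (*-assoc _ _ _) (*-congʳ (reflexive (≡.cong c (≡.sym (ℕ.+-identityʳ i)))))
  monoFrom-decAt (suc p) i (j ∷ js) a e      = trans (*-congˡ (monoFrom-decAt p (suc i) js a e))
    (trans (x∙yz≈y∙xz _ _ _) (*-congʳ (reflexive (≡.cong c (≡.sym (ℕ.+-suc i p))))))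

  monoFrom-++-zeros : ∀ i js d → monoFrom c i (js ++ replicate d 0) ≈ monoFrom c i js
  monoFrom-++-zeros i []       zero    = refl
  monoFrom-++-zeros i []       (suc d) = trans (*-identityˡ _) (monoFrom-++-zeros (suc i) [] d)
  monoFrom-++-zeros i (j ∷ js) d       = *-congˡ (monoFrom-++-zeros (suc i) js d)

  term-++-zeros : ∀ js d → term (js ++ replicate d 0) ≈ term js
  term-++-zeros js d = ×-cong (multinomial-++-zeros js d) (monoFrom-++-zeros 1 js d)

  term-pascal : ∀ js → 1 ≤ sumℕ js → term js ≈ ∑[ p < length js ] peel p js
  term-pascal js 1≤sum = begin
    multinomial js × monoFrom c 1 js
      ≈⟨ ×-cong (multinomial-pascal js (sumℕ js ∸ 1) (≡.sym (ℕ.m+[n∸m]≡n 1≤sum))) refl ⟩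
    ℕΣ.sumTo (length js) g × monoFrom c 1 js
      ≈⟨ ×-homo-sumTo (length js) g (monoFrom c 1 js) ⟩
    ∑[ p < length js ] (g p × monoFrom c 1 js)
      ≈⟨ sumTo-cong (length js) (λ p _ → summand p) ⟩
    ∑[ p < length js ] peel p js ∎
    where
    g : ℕ → ℕ
    g p = ifZero at p js then 0 else multinomial (decAt p js)
    summand : ∀ p → g p × monoFrom c 1 js ≈ peel p js
    summand p with at p js in eq
    ... | zero  = refl
    ... | suc a = trans (×-congʳ (multinomial (decAt p js)) (monoFrom-decAt p 1 js a eq))
                        (sym (×-comm-* (multinomial (decAt p js)) _ _))

  bellSum-0 : bellSum 0 ≈ 1#
  bellSum-0 = trans (+-identityʳ _) (+-identityʳ _)

  y≈bellSum : ∀ n → y c n ≈ bellSum n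
  y≈bellSum n = begin
    sumOver (upTo (suc n)) (bellNorm c n)        ≡⟨ sumTo≡sumOver-upTo (suc n) (bellNorm c n) ⟨
    ∑[ k < suc n ] bellNorm c n k                ≈⟨ sumTo-cong (suc n) (λ k _ → byIndicators k) ⟩
    ∑[ k < suc n ] ∑[ js ∈ tuples n n ] B js k   ≈⟨ sumOver-sumTo-comm (tuples n n) (suc n) B ⟨
    ∑[ js ∈ tuples n n ] ∑[ k < suc n ] B js k   ≈⟨ sumOver-cong (tuples n n) collapse ⟩
    bellSum n                                    ∎
    where
    A : ℕ → List ℕ → Carrier
    A k js = multinom k js × monoFrom c 1 js

    B : List ℕ → ℕ → Carrier
    B js k = [ weightFrom 1 js ≟ n ] [ sumℕ js ≟ k ] A k js

    byIndicators : ∀ k → bellNorm c n k ≈ ∑[ js ∈ tuples n n ] B js k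
    byIndicators k =
      trans (sumOver-filter (λ js → sumℕ js ℕ.≟ k) (filter (λ js → weightFrom 1 js ℕ.≟ n) (tuples n n)) (A k))
            (sumOver-filter (λ js → weightFrom 1 js ℕ.≟ n) (tuples n n) (λ js → [ sumℕ js ≟ k ] A k js))

    collapse : ∀ js → ∑[ k < suc n ] B js k ≈ [ weightFrom 1 js ≟ n ] term js
    collapse js = trans (sym ([≟]-sumTo (weightFrom 1 js) n (suc n) (λ k → [ sumℕ js ≟ k ] A k js)))
      ([≟]-cong (weightFrom 1 js) n (λ wt≡n → sumTo-[≟] (suc n) (sumℕ js) (λ k → A k js)
        (s≤s (ℕ.≤-trans (sumℕ≤weightFrom 0 js) (ℕ.≤-reflexive wt≡n)))))

  sumOver-tuples-weight≈bellSum : ∀ w l b → w ≤ l → w ≤ b →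
                                  ∑[ js ∈ tuples l b ] [ weightFrom 1 js ≟ w ] term js ≈ bellSum w
  sumOver-tuples-weight≈bellSum w l b w≤l w≤b =
    ≡.subst (λ L → ∑[ js ∈ tuples L b ] [ weightFrom 1 js ≟ w ] term js ≈ bellSum w) (ℕ.m+[n∸m]≡n w≤l) (begin
      ∑[ js ∈ tuples (w + (l ∸ w)) b ] [ weightFrom 1 js ≟ w ] term js
        ≈⟨ sumOver-tuples-weight-bound (w + (l ∸ w)) 0 w b w term w≤b ℕ.≤-refl ⟩
      ∑[ js ∈ tuples (w + (l ∸ w)) w ] [ weightFrom 1 js ≟ w ] term js
        ≈⟨ sumOver-tuples-weight-++-zeros w (l ∸ w) 1 w w term (ℕ.n<1+n w) ⟩
      ∑[ js ∈ tuples w w ] [ weightFrom 1 js ≟ w ] term (js ++ replicate (l ∸ w) 0)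
        ≈⟨ sumOver-cong (tuples w w) (λ js → [≟]-cong (weightFrom 1 js) w (λ _ → term-++-zeros js (l ∸ w))) ⟩
      bellSum w ∎)

  bellSum-peel : ∀ n p → p < suc n →
    ∑[ js ∈ tuples (suc n) (suc n) ] [ weightFrom 1 js ≟ suc n ] peel p js ≈ c (suc p) · bellSum (n ∸ p)
  bellSum-peel n p p<N = begin
    sumOver (tuples N N) F
      ≈⟨ sumOver-tuples-incAt N N p F p<N F≈0 ⟩
    ∑[ js ∈ tuples N N ] [ at p js <? N ] F (incAt p js)
      ≈⟨ sumOver-tuples-cong N N shifted ⟩
    ∑[ js ∈ tuples N N ] [ weightFrom 1 js ≟ n ∸ p ] (c (suc p) · term js)
      ≈⟨ sumOver-cong (tuples N N) (λ js → [≟]-*ˡ (weightFrom 1 js) (n ∸ p) (c (suc p)) (term js)) ⟩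
    ∑[ js ∈ tuples N N ] (c (suc p) · [ weightFrom 1 js ≟ n ∸ p ] term js)
      ≈⟨ *-distribˡ-sumOver (tuples N N) (c (suc p)) _ ⟨
    c (suc p) · ∑[ js ∈ tuples N N ] [ weightFrom 1 js ≟ n ∸ p ] term js
      ≈⟨ *-congˡ (sumOver-tuples-weight≈bellSum (n ∸ p) N N n∸p≤N n∸p≤N) ⟩
    c (suc p) · bellSum (n ∸ p) ∎
    where
    N : ℕ
    N = suc n
    n∸p≤N : n ∸ p ≤ N
    n∸p≤N = ℕ.m≤n⇒m≤1+n (ℕ.m∸n≤m n p)

    F : List ℕ → Carrier
    F js = [ weightFrom 1 js ≟ N ] peel p js

    F≈0 : ∀ js → at p js ≡ 0 → F js ≈ 0#
    F≈0 js at≡0 = trans (reflexive (≡.cong (λ t → [ weightFrom 1 js ≟ N ] (ifZero t then 0# else X)) at≡0))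
                        ([≟]-0# (weightFrom 1 js) N)
      where
      X : Carrier
      X = c (suc p) · term (decAt p js)

    shifted : ∀ js → length js ≡ N →
              [ at p js <? N ] F (incAt p js) ≈ [ weightFrom 1 js ≟ n ∸ p ] (c (suc p) · term js)
    shifted js len≡N = trans dropGuard (reflexive F-incAt)
      where
      p<len : p < length js
      p<len = ≡.subst (p <_) (≡.sym len≡N) p<N

      F-incAt : F (incAt p js) ≡ [ weightFrom 1 js ≟ n ∸ p ] (c (suc p) · term js)
      F-incAt = ≡.trans
        (≡.cong₂ (λ w t → [ w ≟ N ] t) (≡.trans (weightFrom-incAt p 1 js p<len) (ℕ.+-comm _ (suc p)))
           (≡.trans (≡.cong (λ t → ifZero t then 0# else (c (suc p) · term (decAt p (incAt p js))))
                            (at-incAt p js p<len))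
                    (≡.cong (λ u → c (suc p) · term u) (decAt-incAt p js))))
        ([+≟]≡[≟∸] (suc p) (weightFrom 1 js) N _ p<N)

      -- If the p-th entry of js is N or more, js weighs more than n ∸ p and both sides vanish.
      dropGuard : [ at p js <? N ] F (incAt p js) ≈ F (incAt p js)
      dropGuard with at p js ℕ.<? N
      ... | yes at<N = reflexive ([<?]-< _ at<N)
      ... | no  at≮N = trans (reflexive ([<?]-≥ _ (ℕ.≮⇒≥ at≮N)))
                         (sym (trans (reflexive F-incAt) (reflexive ([≟]-≢ _ too-heavy))))
        where
        too-heavy : weightFrom 1 js ≢ n ∸ p
        too-heavy wt≡n∸p = ℕ.<-irrefl ≡.refl (ℕ.≤-<-trans
          (ℕ.≤-trans (ℕ.≮⇒≥ at≮N) (ℕ.≤-trans (ℕ.m≤m*n (at p js) (suc p))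
            (ℕ.≤-trans (at*≤weightFrom p 1 js) (ℕ.≤-reflexive wt≡n∸p))))
          (s≤s (ℕ.m∸n≤m n p)))

  bellSum-suc : ∀ n → bellSum (suc n) ≈ ∑[ p < suc n ] (c (suc p) · bellSum (n ∸ p))
  bellSum-suc n = begin
    bellSum N
      ≈⟨ sumOver-tuples-cong N N (λ js len≡N → [≟]-cong (weightFrom 1 js) N (λ wt≡N →
           trans (term-pascal js (positive js wt≡N))
                 (reflexive (≡.cong (λ l → sumTo l (λ p → peel p js)) len≡N)))) ⟩
    ∑[ js ∈ tuples N N ] [ weightFrom 1 js ≟ N ] sumTo N (λ p → peel p js)
      ≈⟨ sumOver-cong (tuples N N) (λ js → [≟]-sumTo (weightFrom 1 js) N N (λ p → peel p js)) ⟩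
    ∑[ js ∈ tuples N N ] ∑[ p < N ] [ weightFrom 1 js ≟ N ] peel p js
      ≈⟨ sumOver-sumTo-comm (tuples N N) N (λ js p → [ weightFrom 1 js ≟ N ] peel p js) ⟩
    ∑[ p < N ] ∑[ js ∈ tuples N N ] [ weightFrom 1 js ≟ N ] peel p js
      ≈⟨ sumTo-cong N (bellSum-peel n) ⟩
    ∑[ p < N ] (c (suc p) · bellSum (n ∸ p)) ∎
    where
    N : ℕ
    N = suc n
    positive : ∀ js → weightFrom 1 js ≡ N → 1 ≤ sumℕ js
    positive js wt≡N with sumℕ js in sum≡
    ... | zero  = ⊥-elim (ℕ.0≢1+n (≡.trans (≡.sym (sumℕ≡0⇒weightFrom≡0 1 js sum≡)) wt≡N))
    ... | suc _ = s≤s z≤n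


  -- C(t) = c₁ t + c₂ t² + ⋯; the value c 0 plays no role.
  C : ℕ → Carrier
  C zero    = 0#
  C (suc m) = c (suc m)

  y-reciprocal : ∀ n → y c n ≈ δ n ⊕ (C ⋆ y c) n
  y-reciprocal zero    = begin
    y c 0                    ≈⟨ y≈bellSum 0 ⟩
    bellSum 0                ≈⟨ bellSum-0 ⟩
    1#                       ≈⟨ +-identityʳ 1# ⟨
    1# ⊕ 0#                  ≈⟨ +-congˡ (trans (+-identityʳ _) (zeroˡ _)) ⟨
    δ 0 ⊕ (C ⋆ y c) 0        ∎
  y-reciprocal (suc n) = begin
    y c (suc n)                                   ≈⟨ y≈bellSum (suc n) ⟩
    bellSum (suc n)                               ≈⟨ bellSum-suc n ⟩
    ∑[ p < suc n ] (c (suc p) · bellSum (n ∸ p))  ≈⟨ sumTo-cong (suc n) (λ p _ →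
                                                       *-congˡ {c (suc p)} (sym (y≈bellSum (n ∸ p)))) ⟩
    ∑[ p < suc n ] (C (suc p) · y c (n ∸ p))      ≈⟨ ⋆-suc C (y c) refl n ⟨
    (C ⋆ y c) (suc n)                             ≈⟨ +-identityˡ _ ⟨
    δ (suc n) ⊕ (C ⋆ y c) (suc n)                 ∎

  yPow≈^⋆ : ∀ r n → yPow c r n ≈ (y c ^⋆ r) n
  yPow≈^⋆ r n = trans (sumOver-filter (λ ms → sumℕ ms ℕ.≟ n) (tuples r n) (λ ms → product (map (y c) ms)))
                      (sumOver-tuples-sumℕ≈^⋆ (y c) r n n ℕ.≤-refl)

theorem3p7 : {a ℓ : Level} (R : CommutativeRing a ℓ) (c : ℕ → CommutativeRing.Carrier R)
    (r : ℕ) → 1 ≤ r → (n : ℕ) → 1 ≤ n →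
    CommutativeRing._≈_ R (Seq._×_ R n (Seq.yPow R c r n))
    (Seq.sumFrom1 R n (λ m → Seq._×_ R (n + m * (r ∸ 1))
    (CommutativeRing._*_ R (c m) (Seq.yPow R c r (n ∸ m)))))
theorem3p7 R c (suc r) (s≤s z≤n) (suc n) (s≤s z≤n) = begin
  suc n × yPow c (suc r) (suc n)
    ≈⟨ ×-congʳ (suc n) (yPow≈^⋆ (suc r) (suc n)) ⟩
  suc n × (y c ^⋆ suc r) (suc n)
    ≈⟨ ^⋆-recurrence refl r n ⟩
  ∑[ i < suc n ] ((suc n + suc i * r) × (C (suc i) · (y c ^⋆ suc r) (n ∸ i)))
    ≈⟨ sumTo-cong (suc n) (λ i _ → ×-congʳ (suc n + suc i * r) (*-congˡ {c (suc i)} (^⋆≈yPow (n ∸ i)))) ⟩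
  ∑[ i < suc n ] ((suc n + suc i * r) × (c (suc i) · yPow c (suc r) (n ∸ i)))
    ≡⟨ sumTo≡sumOver-upTo (suc n) _ ⟩
  sumFrom1 (suc n) (λ m → (suc n + m * r) × (c m · yPow c (suc r) (suc n ∸ m))) ∎
  where
  open CommutativeRing R renaming (_+_ to _⊕_; _*_ to _·_)
  open Seq R using (y; yPow; sumFrom1)
  open FiniteSums commutativeSemiring
  open Convolution commutativeSemiring
  open BellSums R c using (C; y-reciprocal; yPow≈^⋆)
  open Reciprocal C (y c) y-reciprocal
  open import Algebra.Properties.Semiring.Mult semiring using (_×_; ×-congʳ)
  open import Relation.Binary.Reasoning.Setoid setoid

  ^⋆≈yPow : ∀ m → (y c ^⋆ suc r) m ≈ yPow c (suc r) m
  ^⋆≈yPow m = sym (yPow≈^⋆ (suc r) m)
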